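{- Let $M=p_1^{n_1}\cdots p_K^{n_K}$ with distinct primes and $n_\nu\in\mathbb{N}$, let $A\oplus B=\mathbb{Z}_M$, fix $i$, and suppose that $0\in B$ and that the tiling has $A$-uniform $(B,A)$ splitting parity in the $p_i$ direction. Then $\Phi_{p_i^{n_i}}(X)\mid A(X)$.
   Context: $A\oplus B=\mathbb{Z}_M$ means every element of $\mathbb{Z}_M$ is uniquely $a+b$ with $a\in A,b\in B$. $F_i=\{0,M/p_i,\dots,(p_i-1)M/p_i\}$, $x*F_i=\{x+f:f\in F_i\}$. For $Z\subset\mathbb{Z}_M$, $\Sigma_A(Z)=\{a\in A:a+b\in Z\text{ for some }b\in B\}$, $\Sigma_B(Z)$ similarly. A fiber $Z=x*F_i$ splits with parity $(B,A)$ if $p_i^{n_i}\mid b-b'$ for all $b,b'\in\Sigma_B(Z)$ and $p_i^{n_i-1}\,\|\,a-a'$ for all distinct $a,a'\in\Sigma_A(Z)$. The tiling has $A$-uniform $(B,A)$ splitting parity in the $p_i$ direction if every fiber $a*F_i$ with $a\in A$ splits with parity $(B,A)$. $A(X)=\sum_{a\in A}X^a$ (with $A\subset\{0,\dots,M-1\}$); $\Phi_s$ is the $s$-th cyclotomic polynomial. -}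

module Defs where

open import Data.Nat using (ℕ; zero; suc; _+_; _*_; _∸_; _^_; _<_; _<?_; _≟_; NonZero)
open import Data.Nat.DivMod using (_/_; _mod_)
open import Data.Fin using (Fin; toℕ; fromℕ<)
open import Data.Fin.Subset using (Subset; _∈_)
open import Data.Integer as ℤ using (ℤ; +_; 0ℤ; 1ℤ)
open import Data.Integer.Divisibility as ℤD using ()
open import Data.Bool using (if_then_else_)
open import Data.Vec using (lookup)
open import Data.List using (List)
open import Data.Product using (Σ; ∃; _×_; _,_)
open import Relation.Nullary using (¬_; yes; no)
open import Relation.Binary.PropositionalEquality using (_≡_; _≢_)

-- Z_M is represented by Fin M; subsets of Z_M by Data.Fin.Subset.

module _ (M : ℕ) .{{_ : NonZero M}} where

  _+M_ : Fin M → Fin M → Fin M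
  x +M y = (toℕ x + toℕ y) mod M

  IsTiling : Subset M → Subset M → Set
  IsTiling A B =
    ((z : Fin M) → ∃ λ a → ∃ λ b → a ∈ A × b ∈ B × a +M b ≡ z)
    × ((a a' b b' : Fin M) → a ∈ A → a' ∈ A → b ∈ B → b' ∈ B →
         a +M b ≡ a' +M b' → (a ≡ a') × (b ≡ b'))

  -- y ∈ x * F_p, where F_p = {0, M/p, ..., (p-1) M/p}
  InFiber : (p : ℕ) .{{_ : NonZero p}} → Fin M → Fin M → Set
  InFiber p x y = ∃ λ k → k < p × y ≡ x +M ((k * (M / p)) mod M)

  SigmaFiber : Subset M → Subset M → (p : ℕ) .{{_ : NonZero p}} → Fin M → Fin M → Set
  SigmaFiber A B p x a = a ∈ A × ∃ λ b → b ∈ B × InFiber p x (a +M b)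

  -- difference of elements of Z_M as an integer (of representatives);
  -- divisibility by p^j with p^j ∣ M is independent of representatives
  diff : Fin M → Fin M → ℤ
  diff a a' = (+ toℕ a) ℤ.- (+ toℕ a')

  -- the fiber x * F_p splits with parity (B,A), where n is the exponent of p in M
  SplitsBA : Subset M → Subset M → (p : ℕ) .{{_ : NonZero p}} → ℕ → Fin M → Set
  SplitsBA A B p n x =
    ((b b' : Fin M) → SigmaFiber B A p x b → SigmaFiber B A p x b' →
        (+ (p ^ n)) ℤD.∣ diff b b')
    × ((a a' : Fin M) → SigmaFiber A B p x a → SigmaFiber A B p x a' → a ≢ a' →
        ((+ (p ^ (n ∸ 1))) ℤD.∣ diff a a') × ¬ ((+ (p ^ n)) ℤD.∣ diff a a'))

  UniformSplittingBA : Subset M → Subset M → (p : ℕ) .{{_ : NonZero p}} → ℕ → Set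
  UniformSplittingBA A B p n = (a : Fin M) → a ∈ A → SplitsBA A B p n a

  maskCoeff : Subset M → ℕ → ℤ
  maskCoeff A k with k <? M
  ... | yes k<M = if lookup A (fromℕ< k<M) then 1ℤ else 0ℤ
  ... | no _    = 0ℤ

-- Polynomials in ℤ[X], given by coefficient functions ℕ → ℤ

sumBelow : ℕ → (ℕ → ℤ) → ℤ
sumBelow zero    f = 0ℤ
sumBelow (suc n) f = sumBelow n f ℤ.+ f n

-- coefficients of a finite coefficient list (constant term first)
coeff : List ℤ → ℕ → ℤ
coeff List.[] k = 0ℤ
coeff (c List.∷ cs) zero = c
coeff (c List.∷ cs) (suc k) = coeff cs k

mulCoeff : (ℕ → ℤ) → (ℕ → ℤ) → ℕ → ℤ
mulCoeff f g k = sumBelow (suc k) (λ j → f j ℤ.* g (k ∸ j))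

PolyDvd : (ℕ → ℤ) → (ℕ → ℤ) → Set
PolyDvd P Q = Σ (List ℤ) λ R → (k : ℕ) → mulCoeff P (coeff R) k ≡ Q k

δ : ℕ → ℕ → ℤ
δ k m with k ≟ m
... | yes _ = 1ℤ
... | no _  = 0ℤ

-- Φ_{p^n}(X) = Σ_{j < p} X^{j p^{n-1}}  (p prime, n ≥ 1)
cyclotomicPrimePower : ℕ → ℕ → ℕ → ℤ
cyclotomicPrimePower p n k = sumBelow p (λ j → δ k (j * p ^ (n ∸ 1)))

-- Write N = M/p = c·p^(n-1) with p ∤ c, and Φ = Φ_{p^n}. For k < p and a ∈ A decompose
-- a + kN = a′ + b′ with a′ ∈ A, b′ ∈ B. Both 0 and b′ lie in Σ_B(a * F_p), so the splitting
-- parity gives p^n ∣ b′, i.e. a′ ≡ a + kN (mod p^n); uniqueness of decompositions makes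
-- a ↦ a′ a permutation of A. Hence p·A(X) = Σ_k Σ_{a∈A} X^{a′} ≡ Σ_{a∈A} Σ_k X^{a+kN} modulo Φ,
-- because X^u ≡ X^v (mod Φ) whenever u ≡ v (mod p^n). Each Σ_k X^{a+kN} is a multiple of Φ,
-- since k ↦ kc permutes the residues mod p and Φ = Σ_{j<p} X^{j·p^(n-1)}. So Φ ∣ p·A(X), and as
-- Φ(0) = 1 the factor p can be cancelled coefficient by coefficient.

module Submission where

open import Defs
open import Data.Bool using (true; false; if_then_else_)
open import Data.Fin as Fin using (Fin; toℕ)
import Data.Fin.Properties as FinP
open import Data.Fin.Permutation using (permutation)
open import Data.Fin.Subset using (Subset; _∈_; _∉_)
open import Data.Fin.Subset.Properties using (_∈?_)
open import Data.Integer as ℤ using (ℤ; +_; 0ℤ; 1ℤ)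
open import Data.Integer.Divisibility.Signed as ℤ∣ using () renaming (_∣_ to _∣ℤ_)
import Data.Integer.Properties as ℤP
open import Algebra.Properties.Semiring.Sum ℤP.+-*-semiring
  using (sum-syntax; sum-cong-≗; ∑-distrib-+; ∑-comm; *-distribˡ-sum; sum-permute)
open import Data.Integer.Tactic.RingSolver using (solve-∀)
open import Data.List using (List; []; _∷_; map)
open import Data.Nat as ℕ using (ℕ; zero; suc; _+_; _*_; _∸_; _^_; _<_; _≤_; z≤n; s≤s; NonZero; _%_; _/_)
open import Data.Nat.DivMod
  using (_mod_; m≡m%n+[m/n]*n; m*n/n≡m; %-distribˡ-+; %-remove-+ʳ; m%n%n≡m%n; m∣n⇒o%n%m≡o%m)
open import Data.Nat.Divisibility as ℕ∣ using (_∣_)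
open import Data.Nat.Induction using (<-rec)
open import Data.Nat.Primality using (Prime; prime⇒nonZero; euclidsLemma)
import Data.Nat.Properties as ℕP
open import Data.Nat.Tactic.RingSolver as ℕ-Ring using ()
open import Data.Product using (∃; Σ; _,_; proj₁; proj₂)
open import Data.Sum using (inj₁; inj₂)
open import Data.Vec using (lookup)
open import Data.Vec.Properties using ([]=⇒lookup; lookup⇒[]=)
open import Function using (_∘_)
open import Function.Definitions using (Injective)
open import Relation.Nullary using (¬_; Dec; yes; no; contradiction)
open import Relation.Binary.PropositionalEquality

-- Finite sums

sumBelow-cong : ∀ n {f g : ℕ → ℤ} → (∀ {j} → j < n → f j ≡ g j) → sumBelow n f ≡ sumBelow n g
sumBelow-cong zero    f≗g = refl
sumBelow-cong (suc n) f≗g = cong₂ ℤ._+_ (sumBelow-cong n (f≗g ∘ ℕP.m<n⇒m<1+n)) (f≗g ℕP.≤-refl)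

sumBelow-zero : ∀ n {f : ℕ → ℤ} → (∀ {j} → j < n → f j ≡ 0ℤ) → sumBelow n f ≡ 0ℤ
sumBelow-zero zero    f≡0 = refl
sumBelow-zero (suc n) f≡0 = cong₂ ℤ._+_ (sumBelow-zero n (f≡0 ∘ ℕP.m<n⇒m<1+n)) (f≡0 ℕP.≤-refl)

sumBelow-single : ∀ n {f : ℕ → ℤ} {j₀} → j₀ < n → (∀ {j} → j < n → j ≢ j₀ → f j ≡ 0ℤ) →
                  sumBelow n f ≡ f j₀
sumBelow-single (suc n) {f} {j₀} j₀<1+n f≡0 with j₀ ℕ.≟ n
... | yes refl = trans (cong (ℤ._+ f n) (sumBelow-zero n λ j<n → f≡0 (ℕP.m<n⇒m<1+n j<n) (ℕP.<⇒≢ j<n)))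
                       (ℤP.+-identityˡ (f n))
... | no j₀≢n  = trans (cong₂ ℤ._+_ (sumBelow-single n (ℕP.≤∧≢⇒< (ℕP.≤-pred j₀<1+n) j₀≢n)
                                                   (f≡0 ∘ ℕP.m<n⇒m<1+n))
                                  (f≡0 ℕP.≤-refl (j₀≢n ∘ sym)))
                       (ℤP.+-identityʳ (f j₀))

sumBelow-suc : ∀ n (f : ℕ → ℤ) → sumBelow (suc n) f ≡ f 0 ℤ.+ sumBelow n (f ∘ suc)
sumBelow-suc zero    f = trans (ℤP.+-identityˡ (f 0)) (sym (ℤP.+-identityʳ (f 0)))
sumBelow-suc (suc n) f = trans (cong (ℤ._+ f (suc n)) (sumBelow-suc n f))
                               (ℤP.+-assoc (f 0) (sumBelow n (f ∘ suc)) (f (suc n)))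

sumBelow≡∑ : ∀ n (f : ℕ → ℤ) → sumBelow n f ≡ ∑[ i < n ] f (toℕ i)
sumBelow≡∑ zero    f = refl
sumBelow≡∑ (suc n) f = trans (sumBelow-suc n f) (cong (λ s → f 0 ℤ.+ s) (sumBelow≡∑ n (f ∘ suc)))

sumBelow-distrib-+ : ∀ n (f g : ℕ → ℤ) → sumBelow n (λ j → f j ℤ.+ g j) ≡ sumBelow n f ℤ.+ sumBelow n g
sumBelow-distrib-+ n f g = begin
  sumBelow n (λ j → f j ℤ.+ g j)                ≡⟨ sumBelow≡∑ n _ ⟩
  ∑[ i < n ] (f (toℕ i) ℤ.+ g (toℕ i))          ≡⟨ ∑-distrib-+ {n} (f ∘ toℕ) (g ∘ toℕ) ⟩
  ∑[ i < n ] f (toℕ i) ℤ.+ ∑[ i < n ] g (toℕ i) ≡⟨ cong₂ ℤ._+_ (sumBelow≡∑ n f) (sumBelow≡∑ n g) ⟨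
  sumBelow n f ℤ.+ sumBelow n g                 ∎
  where open ≡-Reasoning

*-distribˡ-sumBelow : ∀ n c (f : ℕ → ℤ) → c ℤ.* sumBelow n f ≡ sumBelow n (λ j → c ℤ.* f j)
*-distribˡ-sumBelow n c f = begin
  c ℤ.* sumBelow n f             ≡⟨ cong (c ℤ.*_) (sumBelow≡∑ n f) ⟩
  c ℤ.* ∑[ i < n ] f (toℕ i)     ≡⟨ *-distribˡ-sum {n} c (f ∘ toℕ) ⟩
  ∑[ i < n ] (c ℤ.* f (toℕ i))   ≡⟨ sumBelow≡∑ n _ ⟨
  sumBelow n (λ j → c ℤ.* f j)   ∎
  where open ≡-Reasoning

sumBelow-telescope : ∀ n (g : ℕ → ℤ) → sumBelow n (g ∘ suc) ℤ.- sumBelow n g ≡ g n ℤ.- g 0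
sumBelow-telescope zero    g = sym (ℤP.+-inverseʳ (g 0))
sumBelow-telescope (suc n) g = begin
  (Sg ℤ.+ g (suc n)) ℤ.- (S ℤ.+ g n)      ≡⟨ regroup Sg S (g (suc n)) (g n) ⟩
  (Sg ℤ.- S) ℤ.+ (g (suc n) ℤ.- g n)      ≡⟨ cong (ℤ._+ (g (suc n) ℤ.- g n)) (sumBelow-telescope n g) ⟩
  (g n ℤ.- g 0) ℤ.+ (g (suc n) ℤ.- g n)   ≡⟨ cancel (g n) (g 0) (g (suc n)) ⟩
  g (suc n) ℤ.- g 0                       ∎
  where
  open ≡-Reasoning
  Sg = sumBelow n (g ∘ suc)
  S  = sumBelow n g
  regroup : ∀ s t a b → (s ℤ.+ a) ℤ.- (t ℤ.+ b) ≡ (s ℤ.- t) ℤ.+ (a ℤ.- b)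
  regroup = solve-∀
  cancel : ∀ a b c → (a ℤ.- b) ℤ.+ (c ℤ.- a) ≡ c ℤ.- b
  cancel = solve-∀

injective⇒surjective : ∀ {n} {σ : Fin n → Fin n} → Injective _≡_ _≡_ σ → ∀ y → ∃ λ x → σ x ≡ y
injective⇒surjective {suc n} {σ} σ-inj y with FinP.any? (λ x → σ x Fin.≟ y)
... | yes hit  = hit
... | no  miss = contradiction (FinP.injective⇒≤ punched-injective) ℕP.1+n≰n
  where
  y≢σ : ∀ x → y ≢ σ x
  y≢σ x y≡σx = miss (x , sym y≡σx)
  punched : Fin (suc n) → Fin n
  punched x = Fin.punchOut (y≢σ x)
  punched-injective : Injective _≡_ _≡_ punched
  punched-injective {x} {x′} eq = σ-inj (FinP.punchOut-injective (y≢σ x) (y≢σ x′) eq)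

∑-injective : ∀ {n} (f : Fin n → ℤ) {σ : Fin n → Fin n} → Injective _≡_ _≡_ σ →
              ∑[ i < n ] f (σ i) ≡ ∑[ i < n ] f i
∑-injective f {σ} σ-inj = sym (sum-permute f (permutation σ σ⁻¹ σσ⁻¹ (λ x → σ-inj (σσ⁻¹ (σ x)))))
  where
  σ⁻¹ = proj₁ ∘ injective⇒surjective σ-inj
  σσ⁻¹ = proj₂ ∘ injective⇒surjective σ-inj

∑-const : ∀ n x → ∑[ i < n ] x ≡ + n ℤ.* x
∑-const zero    x = sym (ℤP.*-zeroˡ x)
∑-const (suc n) x = trans (cong (ℤ._+_ x) (∑-const n x)) (sym (ℤP.suc-* (+ n) x))

∣-sumBelow : ∀ {d} n {g : ℕ → ℤ} → (∀ {j} → j < n → d ∣ℤ g j) → d ∣ℤ sumBelow n g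
∣-sumBelow {d} zero    _   = ℤ∣.divides 0ℤ (sym (ℤP.*-zeroˡ d))
∣-sumBelow     (suc n) d∣g = ℤ∣.∣m∣n⇒∣m+n (∣-sumBelow n (d∣g ∘ ℕP.m<n⇒m<1+n)) (d∣g ℕP.≤-refl)

-- Congruences of natural numbers

infix 4 _≡_[mod_]
_≡_[mod_] : ℕ → ℕ → (d : ℕ) → .{{NonZero d}} → Set
m ≡ n [mod d ] = m % d ≡ n % d

module _ {d : ℕ} .{{_ : NonZero d}} where

  ≡[mod]⇒∣∸ : ∀ {m n} → m ≡ n [mod d ] → d ∣ m ∸ n
  ≡[mod]⇒∣∸ {m} {n} m≡n = ℕ∣.divides (m / d ∸ n / d) (begin
    m ∸ n                                        ≡⟨ cong₂ _∸_ (m≡m%n+[m/n]*n m d) (m≡m%n+[m/n]*n n d) ⟩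
    (m % d + m / d * d) ∸ (n % d + n / d * d)    ≡⟨ cong (λ r → (r + m / d * d) ∸ (n % d + n / d * d)) m≡n ⟩
    (n % d + m / d * d) ∸ (n % d + n / d * d)    ≡⟨ ℕP.[m+n]∸[m+o]≡n∸o (n % d) _ _ ⟩
    m / d * d ∸ n / d * d                        ≡⟨ ℕP.*-distribʳ-∸ d (m / d) (n / d) ⟨
    (m / d ∸ n / d) * d                          ∎)
    where open ≡-Reasoning

  ∣∸⇒≡[mod] : ∀ {m n} → n ≤ m → d ∣ m ∸ n → m ≡ n [mod d ]
  ∣∸⇒≡[mod] {m} {n} n≤m d∣m∸n = trans (cong (_% d) (sym (ℕP.m+[n∸m]≡n n≤m))) (%-remove-+ʳ n d∣m∸n)

  ≡[mod]-cancelˡ-+ : ∀ k {m n} → k + m ≡ k + n [mod d ] → m ≡ n [mod d ]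
  ≡[mod]-cancelˡ-+ k {m} {n} k+m≡k+n with ℕP.≤-total n m
  ... | inj₁ n≤m = ∣∸⇒≡[mod] n≤m (subst (d ∣_) (ℕP.[m+n]∸[m+o]≡n∸o k m n) (≡[mod]⇒∣∸ k+m≡k+n))
  ... | inj₂ m≤n = sym (∣∸⇒≡[mod] m≤n (subst (d ∣_) (ℕP.[m+n]∸[m+o]≡n∸o k n m) (≡[mod]⇒∣∸ (sym k+m≡k+n))))

  ≡[mod]-+ : ∀ {m m′ n n′} → m ≡ m′ [mod d ] → n ≡ n′ [mod d ] → m + n ≡ m′ + n′ [mod d ]
  ≡[mod]-+ {m} {m′} {n} {n′} m≡m′ n≡n′ =
    trans (%-distribˡ-+ m n d) (trans (cong₂ (λ a b → (a + b) % d) m≡m′ n≡n′) (sym (%-distribˡ-+ m′ n′ d)))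

  %-≡[mod] : ∀ m → m % d ≡ m [mod d ]
  %-≡[mod] m = m%n%n≡m%n m d

  +-∣-≡[mod] : ∀ m {k} → d ∣ k → m + k ≡ m [mod d ]
  +-∣-≡[mod] m d∣k = %-remove-+ʳ m d∣k

≡[mod]-weaken : ∀ {e d m n} .{{_ : NonZero e}} .{{_ : NonZero d}} → e ∣ d → m ≡ n [mod d ] → m ≡ n [mod e ]
≡[mod]-weaken {e} {d} {m} {n} e∣d m≡n =
  trans (sym (m∣n⇒o%n%m≡o%m e d m e∣d)) (trans (cong (_% e) m≡n) (m∣n⇒o%n%m≡o%m e d n e∣d))

∣∧<⇒≡0 : ∀ {d m} → d ∣ m → m < d → m ≡ 0
∣∧<⇒≡0 {m = zero}  _   _   = refl
∣∧<⇒≡0 {m = suc m} d∣m m<d = contradiction (ℕ∣.∣⇒≤ d∣m) (ℕP.<⇒≱ m<d)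

module _ {p : ℕ} .{{_ : NonZero p}} (p-prime : Prime p) {c : ℕ} (p∤c : ¬ p ∣ c) where

  *-cancelʳ-≡[mod] : ∀ {x y} → x < p → y < p → x * c ≡ y * c [mod p ] → x ≡ y
  *-cancelʳ-≡[mod] x<p y<p xc≡yc = ℕP.≤-antisym (≤-from x<p xc≡yc) (≤-from y<p (sym xc≡yc))
    where
    ≤-from : ∀ {x y} → x < p → x * c ≡ y * c [mod p ] → x ≤ y
    ≤-from {x} {y} x<p xc≡yc with euclidsLemma (x ∸ y) c p-prime
                                    (subst (p ∣_) (sym (ℕP.*-distribʳ-∸ c x y)) (≡[mod]⇒∣∸ xc≡yc))
    ... | inj₁ p∣x∸y = ℕP.m∸n≡0⇒m≤n (∣∧<⇒≡0 p∣x∸y (ℕP.≤-<-trans (ℕP.m∸n≤m x y) x<p))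
    ... | inj₂ p∣c   = contradiction p∣c p∤c

-- Polynomials as coefficient functions

Poly : Set
Poly = ℕ → ℤ

X^ : ℕ → Poly
X^ a k = δ k a

δ-≡ : ∀ {k m} → k ≡ m → δ k m ≡ 1ℤ
δ-≡ {k} {m} k≡m with k ℕ.≟ m
... | yes _   = refl
... | no  k≢m = contradiction k≡m k≢m

δ-≢ : ∀ {k m} → k ≢ m → δ k m ≡ 0ℤ
δ-≢ {k} {m} k≢m with k ℕ.≟ m
... | yes k≡m = contradiction k≡m k≢m
... | no  _   = refl

δ-+ : ∀ a k m → δ (a + k) (a + m) ≡ δ k m
δ-+ a k m with k ℕ.≟ m
... | yes k≡m = δ-≡ (cong (_+_ a) k≡m)
... | no  k≢m = δ-≢ (k≢m ∘ ℕP.+-cancelˡ-≡ a k m)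

monomial : ℕ → List ℤ
monomial zero    = 1ℤ ∷ []
monomial (suc a) = 0ℤ ∷ monomial a

coeff-monomial : ∀ a → coeff (monomial a) ≗ X^ a
coeff-monomial zero    zero    = refl
coeff-monomial zero    (suc k) = refl
coeff-monomial (suc a) zero    = refl
coeff-monomial (suc a) (suc k) = trans (coeff-monomial a k) (sym (δ-+ 1 k a))

∑-monomials : ∀ n (w : Poly) → (∀ {i} → n ≤ i → w i ≡ 0ℤ) →
              ∀ i → w i ≡ ∑[ x < n ] (w (toℕ x) ℤ.* X^ (toℕ x) i)
∑-monomials n w w≡0 i = trans expansion (sumBelow≡∑ n (λ e → w e ℤ.* X^ e i))
  where
  expansion : w i ≡ sumBelow n (λ e → w e ℤ.* X^ e i)
  expansion with i ℕ.<? n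
  ... | yes i<n = sym (trans (sumBelow-single n i<n (λ {e} _ e≢i → trans (cong (w e ℤ.*_) (δ-≢ (e≢i ∘ sym)))
                                                                          (ℤP.*-zeroʳ (w e))))
                             (trans (cong (w i ℤ.*_) (δ-≡ refl)) (ℤP.*-identityʳ (w i))))
  ... | no  i≮n = trans (w≡0 (ℕP.≮⇒≥ i≮n)) (sym (sumBelow-zero n λ {e} e<n →
                    trans (cong (w e ℤ.*_) (δ-≢ λ i≡e → i≮n (subst (_< n) (sym i≡e) e<n)))
                          (ℤP.*-zeroʳ (w e))))

mulCoeff-congʳ : ∀ f {g h : Poly} → g ≗ h → mulCoeff f g ≗ mulCoeff f h
mulCoeff-congʳ f g≗h k = sumBelow-cong (suc k) (λ {j} _ → cong (f j ℤ.*_) (g≗h (k ∸ j)))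

mulCoeff-+ʳ : ∀ f (g h : Poly) k →
              mulCoeff f (λ i → g i ℤ.+ h i) k ≡ mulCoeff f g k ℤ.+ mulCoeff f h k
mulCoeff-+ʳ f g h k = trans (sumBelow-cong (suc k) (λ {j} _ → ℤP.*-distribˡ-+ (f j) _ _))
                            (sumBelow-distrib-+ (suc k) _ _)

mulCoeff-*ʳ : ∀ f (g : Poly) c k → mulCoeff f (λ i → c ℤ.* g i) k ≡ c ℤ.* mulCoeff f g k
mulCoeff-*ʳ f g c k = trans (sumBelow-cong (suc k) (λ {j} _ → swap (f j) c (g (k ∸ j))))
                            (sym (*-distribˡ-sumBelow (suc k) c _))
  where
  swap : ∀ x y z → x ℤ.* (y ℤ.* z) ≡ y ℤ.* (x ℤ.* z)
  swap = solve-∀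

mulCoeff-monomial : ∀ f a k → mulCoeff f (coeff (monomial a)) (a + k) ≡ f k
mulCoeff-monomial f a k = begin
  mulCoeff f (coeff (monomial a)) (a + k)  ≡⟨ mulCoeff-congʳ f (coeff-monomial a) (a + k) ⟩
  mulCoeff f (X^ a) (a + k)                ≡⟨ sumBelow-single (suc (a + k)) (s≤s (ℕP.m≤n+m k a)) vanish ⟩
  f k ℤ.* δ (a + k ∸ k) a                  ≡⟨ cong (f k ℤ.*_) (δ-≡ (ℕP.m+n∸n≡m a k)) ⟩
  f k ℤ.* 1ℤ                               ≡⟨ ℤP.*-identityʳ (f k) ⟩
  f k                                      ∎
  where
  open ≡-Reasoning
  vanish : ∀ {j} → j < suc (a + k) → j ≢ k → f j ℤ.* δ (a + k ∸ j) a ≡ 0ℤ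
  vanish {j} j≤a+k j≢k = trans (cong (f j ℤ.*_) (δ-≢ λ e → j≢k (begin
    j                        ≡⟨ ℕP.m∸[m∸n]≡n (ℕP.≤-pred j≤a+k) ⟨
    a + k ∸ (a + k ∸ j)      ≡⟨ cong (a + k ∸_) e ⟩
    a + k ∸ a                ≡⟨ ℕP.m+n∸m≡n a k ⟩
    k                        ∎)))
    (ℤP.*-zeroʳ (f j))

mulCoeff-monomial-< : ∀ f {a k} → k < a → mulCoeff f (coeff (monomial a)) k ≡ 0ℤ
mulCoeff-monomial-< f {a} {k} k<a = sumBelow-zero (suc k) λ {j} _ →
  trans (cong (f j ℤ.*_) (trans (coeff-monomial a (k ∸ j))
                                (δ-≢ λ e → ℕP.<⇒≢ (ℕP.≤-<-trans (ℕP.m∸n≤m k j) k<a) e)))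
        (ℤP.*-zeroʳ (f j))

_+ᴸ_ : List ℤ → List ℤ → List ℤ
[]       +ᴸ S        = S
(r ∷ R)  +ᴸ []       = r ∷ R
(r ∷ R)  +ᴸ (s ∷ S)  = (r ℤ.+ s) ∷ (R +ᴸ S)

coeff-+ᴸ : ∀ R S k → coeff (R +ᴸ S) k ≡ coeff R k ℤ.+ coeff S k
coeff-+ᴸ []      S       k       = sym (ℤP.+-identityˡ _)
coeff-+ᴸ (r ∷ R) []      k       = sym (ℤP.+-identityʳ _)
coeff-+ᴸ (r ∷ R) (s ∷ S) zero    = refl
coeff-+ᴸ (r ∷ R) (s ∷ S) (suc k) = coeff-+ᴸ R S k

coeff-map : ∀ (h : ℤ → ℤ) → h 0ℤ ≡ 0ℤ → ∀ R → coeff (map h R) ≗ h ∘ coeff R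
coeff-map h h0≡0 []      k       = sym h0≡0
coeff-map h h0≡0 (r ∷ R) zero    = refl
coeff-map h h0≡0 (r ∷ R) (suc k) = coeff-map h h0≡0 R k

∣-mulCoeff⇒∣ : ∀ {f g : Poly} {d} → f 0 ≡ 1ℤ → (∀ k → d ∣ℤ mulCoeff f g k) → ∀ k → d ∣ℤ g k
∣-mulCoeff⇒∣ {f} {g} {d} f₀≡1 d∣fg = <-rec (λ k → d ∣ℤ g k) step
  where
  step : ∀ k → (∀ {j} → j < k → d ∣ℤ g j) → d ∣ℤ g k
  step k d∣g< = subst (d ∣ℤ_) isolate (ℤ∣.∣m∣n⇒∣m-n (d∣fg k) (∣-sumBelow k d∣term))
    where
    term : ℕ → ℤ
    term j = f (suc j) ℤ.* g (k ∸ suc j)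
    d∣term : ∀ {j} → j < k → d ∣ℤ term j
    d∣term {j} j<k = ℤ∣.∣n⇒∣m*n (f (suc j)) (d∣g< (ℕP.∸-monoʳ-< (s≤s z≤n) j<k))
    isolate : mulCoeff f g k ℤ.- sumBelow k term ≡ g k
    isolate = begin
      mulCoeff f g k ℤ.- sumBelow k term
        ≡⟨ cong (ℤ._- sumBelow k term) (sumBelow-suc k _) ⟩
      (f 0 ℤ.* g k ℤ.+ sumBelow k term) ℤ.- sumBelow k term
        ≡⟨ +-∸ (f 0 ℤ.* g k) (sumBelow k term) ⟩
      f 0 ℤ.* g k
        ≡⟨ cong (ℤ._* g k) f₀≡1 ⟩
      1ℤ ℤ.* g k
        ≡⟨ ℤP.*-identityˡ (g k) ⟩
      g k  ∎
      where
      open ≡-Reasoning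
      +-∸ : ∀ x s → (x ℤ.+ s) ℤ.- s ≡ x
      +-∸ = solve-∀

quotients : ∀ d (R : List ℤ) → (∀ k → d ∣ℤ coeff R k) →
            Σ (List ℤ) λ R′ → coeff R ≗ λ k → d ℤ.* coeff R′ k
quotients d []      _     = [] , λ _ → sym (ℤP.*-zeroʳ d)
quotients d (r ∷ R) d∣rR with quotients d R (d∣rR ∘ suc)
... | R′ , R≗dR′ = ℤ∣.quotient (d∣rR 0) ∷ R′ , λ
  { zero    → trans (ℤ∣._∣_.equality (d∣rR 0)) (ℤP.*-comm _ d)
  ; (suc k) → R≗dR′ k }

module Multiples (f : Poly) where

  PolyDvd-resp : ∀ {P Q} → P ≗ Q → PolyDvd f P → PolyDvd f Q
  PolyDvd-resp P≗Q (R , fR≡P) = R , λ k → trans (fR≡P k) (P≗Q k)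

  PolyDvd-0 : PolyDvd f (λ _ → 0ℤ)
  PolyDvd-0 = [] , λ k → sumBelow-zero (suc k) (λ {j} _ → ℤP.*-zeroʳ (f j))

  PolyDvd-+ : ∀ {P Q} → PolyDvd f P → PolyDvd f Q → PolyDvd f (λ k → P k ℤ.+ Q k)
  PolyDvd-+ (R , fR≡P) (S , fS≡Q) = R +ᴸ S , λ k →
    trans (mulCoeff-congʳ f (coeff-+ᴸ R S) k)
          (trans (mulCoeff-+ʳ f (coeff R) (coeff S) k) (cong₂ ℤ._+_ (fR≡P k) (fS≡Q k)))

  PolyDvd-* : ∀ c {P} → PolyDvd f P → PolyDvd f (λ k → c ℤ.* P k)
  PolyDvd-* c (R , fR≡P) = map (c ℤ.*_) R , λ k →
    trans (mulCoeff-congʳ f (coeff-map (c ℤ.*_) (ℤP.*-zeroʳ c) R) k)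
          (trans (mulCoeff-*ʳ f (coeff R) c k) (cong (c ℤ.*_) (fR≡P k)))

  PolyDvd-- : ∀ {P Q} → PolyDvd f P → PolyDvd f Q → PolyDvd f (λ k → P k ℤ.- Q k)
  PolyDvd-- {Q = Q} f∣P f∣Q =
    PolyDvd-+ f∣P (PolyDvd-resp (ℤP.-1*i≡-i ∘ Q) (PolyDvd-* (ℤ.- 1ℤ) f∣Q))

  PolyDvd-∑ : ∀ {n} {F : Fin n → Poly} → (∀ i → PolyDvd f (F i)) → PolyDvd f (λ k → ∑[ i < n ] F i k)
  PolyDvd-∑ {zero}  f∣F = PolyDvd-0
  PolyDvd-∑ {suc n} f∣F = PolyDvd-+ (f∣F Fin.zero) (PolyDvd-∑ (f∣F ∘ Fin.suc))

  PolyDvd-shift : ∀ a (g : Poly) → (∀ k → g (a + k) ≡ f k) → (∀ {k} → k < a → g k ≡ 0ℤ) →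
                  PolyDvd f g
  PolyDvd-shift a g g[a+k]≡f g<a≡0 = monomial a , coeffs
    where
    coeffs : ∀ i → mulCoeff f (coeff (monomial a)) i ≡ g i
    coeffs i with a ℕ.≤? i
    ... | yes a≤i = subst (λ i → mulCoeff f (coeff (monomial a)) i ≡ g i) (ℕP.m+[n∸m]≡n a≤i)
                          (trans (mulCoeff-monomial f a (i ∸ a)) (sym (g[a+k]≡f (i ∸ a))))
    ... | no  a≰i = trans (mulCoeff-monomial-< f (ℕP.≰⇒> a≰i)) (sym (g<a≡0 (ℕP.≰⇒> a≰i)))

  module _ {Q : Poly} (d : ℤ) .{{_ : ℤ.NonZero d}} where

    private
      PolyDvd-divide : (R : List ℤ) → (∀ k → mulCoeff f (coeff R) k ≡ d ℤ.* Q k) →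
                       (∀ k → d ∣ℤ coeff R k) → PolyDvd f Q
      PolyDvd-divide R fR≡dQ d∣R with quotients d R d∣R
      ... | R′ , R≗dR′ = R′ , λ k → ℤP.*-cancelˡ-≡ d (mulCoeff f (coeff R′) k) (Q k) (begin
        d ℤ.* mulCoeff f (coeff R′) k            ≡⟨ mulCoeff-*ʳ f (coeff R′) d k ⟨
        mulCoeff f (λ i → d ℤ.* coeff R′ i) k    ≡⟨ mulCoeff-congʳ f R≗dR′ k ⟨
        mulCoeff f (coeff R) k                   ≡⟨ fR≡dQ k ⟩
        d ℤ.* Q k                                ∎)
        where open ≡-Reasoning

    PolyDvd-cancelˡ : f 0 ≡ 1ℤ → PolyDvd f (λ k → d ℤ.* Q k) → PolyDvd f Q
    PolyDvd-cancelˡ f₀≡1 (R , fR≡dQ) = PolyDvd-divide R fR≡dQ (∣-mulCoeff⇒∣ {f} f₀≡1 d∣fR)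
      where
      d∣fR : ∀ k → d ∣ℤ mulCoeff f (coeff R) k
      d∣fR k = subst (d ∣ℤ_) (sym (fR≡dQ k)) (ℤ∣.∣m⇒∣m*n (Q k) ℤ∣.∣-refl)

-- The cyclotomic polynomial Φ_{p^(n+1)} = Σ_{j<p} X^(j·p^n)

module Cyclotomic (p n : ℕ) .{{_ : NonZero p}} where

  q P : ℕ
  q = p ^ n
  P = p ^ suc n

  instance
    P-nonZero : NonZero P
    P-nonZero = ℕP.m^n≢0 p (suc n)

  Φ : Poly
  Φ = cyclotomicPrimePower p (suc n)

  open Multiples Φ

  Φ-0 : Φ 0 ≡ 1ℤ
  Φ-0 = sumBelow-single p (ℕ.>-nonZero⁻¹ p) λ {j} _ j≢0 →
    δ-≢ (λ 0≡jq → j≢0 (ℕP.m*n≡0⇒m≡0 j q {{ℕP.m^n≢0 p n}} (sym 0≡jq)))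

  Φ∣X^a·Φ : ∀ a → PolyDvd Φ (λ k → sumBelow p (λ j → X^ (a + j * q) k))
  Φ∣X^a·Φ a = PolyDvd-shift a _ (λ k → sumBelow-cong p (λ {j} _ → δ-+ a k (j * q)))
    (λ k<a → sumBelow-zero p (λ {j} _ → δ-≢ (λ k≡ → ℕP.<⇒≱ k<a (subst (a ≤_) (sym k≡) (ℕP.m≤m+n a _)))))

  Φ∣X^[r+P]-X^r : ∀ r → PolyDvd Φ (λ k → X^ (r + P) k ℤ.- X^ r k)
  Φ∣X^[r+P]-X^r r = PolyDvd-resp telescope (PolyDvd-- (Φ∣X^a·Φ (r + q)) (Φ∣X^a·Φ r))
    where
    open ≡-Reasoning
    telescope : ∀ k → sumBelow p (λ j → X^ (r + q + j * q) k) ℤ.- sumBelow p (λ j → X^ (r + j * q) k)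
                      ≡ X^ (r + P) k ℤ.- X^ r k
    telescope k = begin
      sumBelow p (λ j → X^ (r + q + j * q) k) ℤ.- sumBelow p (λ j → X^ (r + j * q) k)
        ≡⟨ cong (ℤ._- sumBelow p (λ j → X^ (r + j * q) k))
                (sumBelow-cong p (λ {j} _ → cong (δ k) (ℕP.+-assoc r q (j * q)))) ⟩
      sumBelow p (λ j → X^ (r + suc j * q) k) ℤ.- sumBelow p (λ j → X^ (r + j * q) k)
        ≡⟨ sumBelow-telescope p (λ j → X^ (r + j * q) k) ⟩
      X^ (r + P) k ℤ.- X^ (r + 0) k
        ≡⟨ cong (λ r′ → X^ (r + P) k ℤ.- X^ r′ k) (ℕP.+-identityʳ r) ⟩
      X^ (r + P) k ℤ.- X^ r k  ∎

  Φ∣X^[r+tP]-X^r : ∀ r t → PolyDvd Φ (λ k → X^ (r + t * P) k ℤ.- X^ r k)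
  Φ∣X^[r+tP]-X^r r zero    = PolyDvd-resp vanish PolyDvd-0
    where
    vanish : ∀ k → 0ℤ ≡ X^ (r + 0) k ℤ.- X^ r k
    vanish k = sym (trans (cong (λ r′ → X^ r′ k ℤ.- X^ r k) (ℕP.+-identityʳ r)) (ℤP.+-inverseʳ (X^ r k)))
  Φ∣X^[r+tP]-X^r r (suc t) = PolyDvd-resp chain (PolyDvd-+ (Φ∣X^[r+P]-X^r (r + t * P)) (Φ∣X^[r+tP]-X^r r t))
    where
    chain : ∀ k → (X^ (r + t * P + P) k ℤ.- X^ (r + t * P) k) ℤ.+ (X^ (r + t * P) k ℤ.- X^ r k)
                  ≡ X^ (r + suc t * P) k ℤ.- X^ r k
    chain k = trans (collapse (X^ (r + t * P + P) k) (X^ (r + t * P) k) (X^ r k))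
                    (cong (λ e → X^ e k ℤ.- X^ r k) (regroup r (t * P) P))
      where
      collapse : ∀ a b c → (a ℤ.- b) ℤ.+ (b ℤ.- c) ≡ a ℤ.- c
      collapse = solve-∀
      regroup : ∀ r s t → r + s + t ≡ r + (t + s)
      regroup = ℕ-Ring.solve-∀

  Φ∣X^u-X^v : ∀ {u v} → u ≡ v [mod P ] → PolyDvd Φ (λ k → X^ u k ℤ.- X^ v k)
  Φ∣X^u-X^v {u} {v} u≡v = PolyDvd-resp difference
    (PolyDvd-- (Φ∣X^[r+tP]-X^r (u % P) (u / P)) (Φ∣X^[r+tP]-X^r (v % P) (v / P)))
    where
    difference : ∀ k → (X^ (u % P + u / P * P) k ℤ.- X^ (u % P) k)
                         ℤ.- (X^ (v % P + v / P * P) k ℤ.- X^ (v % P) k)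
                       ≡ X^ u k ℤ.- X^ v k
    difference k = begin
      (X^ (u % P + u / P * P) k ℤ.- X^ (u % P) k) ℤ.- (X^ (v % P + v / P * P) k ℤ.- X^ (v % P) k)
        ≡⟨ cong₂ (λ a b → (X^ a k ℤ.- X^ (u % P) k) ℤ.- (X^ b k ℤ.- X^ (v % P) k))
                 (m≡m%n+[m/n]*n u P) (m≡m%n+[m/n]*n v P) ⟨
      (X^ u k ℤ.- X^ (u % P) k) ℤ.- (X^ v k ℤ.- X^ (v % P) k)
        ≡⟨ cong (λ r → (X^ u k ℤ.- X^ (u % P) k) ℤ.- (X^ v k ℤ.- X^ r k)) u≡v ⟨
      (X^ u k ℤ.- X^ (u % P) k) ℤ.- (X^ v k ℤ.- X^ (u % P) k)
        ≡⟨ cancel (X^ u k) (X^ v k) (X^ (u % P) k) ⟩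
      X^ u k ℤ.- X^ v k  ∎
      where
      open ≡-Reasoning
      cancel : ∀ a b r → (a ℤ.- r) ℤ.- (b ℤ.- r) ≡ a ℤ.- b
      cancel = solve-∀

  module _ (p-prime : Prime p) {c : ℕ} (p∤c : ¬ p ∣ c) where

    private
      σ : Fin p → Fin p
      σ j = (toℕ j * c) mod p

      toℕ-σ : ∀ j → toℕ (σ j) ≡ toℕ j * c % p
      toℕ-σ j = FinP.toℕ-fromℕ< _

      σ-injective : Injective _≡_ _≡_ σ
      σ-injective {i} {j} σi≡σj = FinP.toℕ-injective
        (*-cancelʳ-≡[mod] p-prime p∤c (FinP.toℕ<n i) (FinP.toℕ<n j)
                          (trans (sym (toℕ-σ i)) (trans (cong toℕ σi≡σj) (toℕ-σ j))))

    Φ∣∑X^[a+jcq] : ∀ a → PolyDvd Φ (λ k → ∑[ j < p ] X^ (a + toℕ j * (c * q)) k)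
    Φ∣∑X^[a+jcq] a = PolyDvd-resp recombine
      (PolyDvd-+ (PolyDvd-∑ (λ j → Φ∣X^u-X^v (congruent j))) (PolyDvd-resp permuted (Φ∣X^a·Φ a)))
      where
      congruent : ∀ j → a + toℕ j * (c * q) ≡ a + toℕ (σ j) * q [mod P ]
      congruent j = trans (cong (_% P) expand) (+-∣-≡[mod] {P} _ (ℕ∣.n∣m*n (m / p)))
        where
        m = toℕ j * c
        open ≡-Reasoning
        expand : a + toℕ j * (c * q) ≡ (a + toℕ (σ j) * q) + m / p * P
        expand = begin
          a + toℕ j * (c * q)              ≡⟨ cong (_+_ a) (ℕP.*-assoc (toℕ j) c q) ⟨
          a + m * q                        ≡⟨ cong (λ x → a + x * q) (m≡m%n+[m/n]*n m p) ⟩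
          a + (m % p + m / p * p) * q      ≡⟨ regroup a (m % p) (m / p) p q ⟩
          (a + m % p * q) + m / p * P      ≡⟨ cong (λ r → (a + r * q) + m / p * P) (toℕ-σ j) ⟨
          (a + toℕ (σ j) * q) + m / p * P  ∎
          where
          regroup : ∀ a r t p q → a + (r + t * p) * q ≡ (a + r * q) + t * (p * q)
          regroup = ℕ-Ring.solve-∀
      permuted : ∀ k → sumBelow p (λ j → X^ (a + j * q) k) ≡ ∑[ j < p ] X^ (a + toℕ (σ j) * q) k
      permuted k = trans (sumBelow≡∑ p _) (sym (∑-injective (λ j → X^ (a + toℕ j * q) k) σ-injective))
      recombine : ∀ k → ∑[ j < p ] (X^ (a + toℕ j * (c * q)) k ℤ.- X^ (a + toℕ (σ j) * q) k)
                          ℤ.+ ∑[ j < p ] X^ (a + toℕ (σ j) * q) k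
                        ≡ ∑[ j < p ] X^ (a + toℕ j * (c * q)) k
      recombine k = trans (sym (∑-distrib-+ {p} _ _)) (sum-cong-≗ {p} (λ j → minus-plus _ _))
        where
        minus-plus : ∀ x y → (x ℤ.- y) ℤ.+ y ≡ x
        minus-plus = solve-∀

-- Mask polynomials and translation along fibers

module _ (M : ℕ) .{{_ : NonZero M}} (A : Subset M) where

  maskCoeff-≥ : ∀ {i} → M ≤ i → maskCoeff M A i ≡ 0ℤ
  maskCoeff-≥ {i} M≤i with i ℕ.<? M
  ... | yes i<M = contradiction i<M (ℕP.≤⇒≯ M≤i)
  ... | no  _   = refl

  maskCoeff-toℕ : ∀ x → maskCoeff M A (toℕ x) ≡ (if lookup A x then 1ℤ else 0ℤ)
  maskCoeff-toℕ x with toℕ x ℕ.<? M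
  ... | yes x<M = cong (λ y → if lookup A y then 1ℤ else 0ℤ) (FinP.fromℕ<-toℕ x x<M)
  ... | no  x≮M = contradiction (FinP.toℕ<n x) x≮M

  maskCoeff-∈ : ∀ {x} → x ∈ A → maskCoeff M A (toℕ x) ≡ 1ℤ
  maskCoeff-∈ {x} x∈A = trans (maskCoeff-toℕ x) (cong (λ b → if b then 1ℤ else 0ℤ) ([]=⇒lookup x∈A))

  maskCoeff-∉ : ∀ {x} → x ∉ A → maskCoeff M A (toℕ x) ≡ 0ℤ
  maskCoeff-∉ {x} x∉A with lookup A x in Ax
  ... | true  = contradiction (lookup⇒[]= x A Ax) x∉A
  ... | false = trans (maskCoeff-toℕ x) (cong (λ b → if b then 1ℤ else 0ℤ) Ax)

module Translation (M : ℕ) .{{_ : NonZero M}} (p n : ℕ) .{{_ : NonZero p}}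
                   (A B : Subset M) (tiling : IsTiling M A B) (0∈B : (0 mod M) ∈ B)
                   (splitting : UniformSplittingBA M A B p n) (pⁿ∣M : p ^ n ∣ M) where

  instance
    pⁿ-nonZero : NonZero (p ^ n)
    pⁿ-nonZero = ℕP.m^n≢0 p n

  infixl 6 _⊕_
  _⊕_ : Fin M → Fin M → Fin M
  _⊕_ = _+M_ M

  toℕ-⊕ : ∀ x y → toℕ (x ⊕ y) ≡ (toℕ x + toℕ y) % M
  toℕ-⊕ x y = FinP.toℕ-fromℕ< _

  ⊕-comm : ∀ x y → x ⊕ y ≡ y ⊕ x
  ⊕-comm x y = FinP.toℕ-injective (trans (toℕ-⊕ x y)
                 (trans (cong (_% M) (ℕP.+-comm (toℕ x) (toℕ y))) (sym (toℕ-⊕ y x))))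

  ⊕-≡⇒≡[mod] : ∀ {x y x′ y′} → x ⊕ y ≡ x′ ⊕ y′ → toℕ x + toℕ y ≡ toℕ x′ + toℕ y′ [mod M ]
  ⊕-≡⇒≡[mod] {x} {y} {x′} {y′} eq = trans (sym (toℕ-⊕ x y)) (trans (cong toℕ eq) (toℕ-⊕ x′ y′))

  ≡[mod]⇒⊕-≡ : ∀ {x y x′ y′} → toℕ x + toℕ y ≡ toℕ x′ + toℕ y′ [mod M ] → x ⊕ y ≡ x′ ⊕ y′
  ≡[mod]⇒⊕-≡ {x} {y} {x′} {y′} eq = FinP.toℕ-injective (trans (toℕ-⊕ x y) (trans eq (sym (toℕ-⊕ x′ y′))))

  fiberStep : ℕ → Fin M
  fiberStep k = (k * (M / p)) mod M

  toℕ-fiberStep : ∀ k → toℕ (fiberStep k) ≡ k * (M / p) % M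
  toℕ-fiberStep k = FinP.toℕ-fromℕ< _

  ∣diff-0∣ : ∀ b → ℤ.∣ diff M (0 mod M) b ∣ ≡ toℕ b
  ∣diff-0∣ b = begin
    ℤ.∣ + toℕ (0 mod M) ℤ.- + toℕ b ∣  ≡⟨ cong (λ z → ℤ.∣ + z ℤ.- + toℕ b ∣) (FinP.toℕ-fromℕ< _) ⟩
    ℤ.∣ + (0 % M) ℤ.- + toℕ b ∣        ≡⟨ cong (λ z → ℤ.∣ + z ℤ.- + toℕ b ∣) (ℕ∣.n∣m⇒m%n≡0 0 M (ℕ∣._∣0 M)) ⟩
    ℤ.∣ 0ℤ ℤ.- + toℕ b ∣               ≡⟨ cong ℤ.∣_∣ (ℤP.+-identityˡ (ℤ.- + toℕ b)) ⟩
    ℤ.∣ ℤ.- + toℕ b ∣                  ≡⟨ ℤP.∣-i∣≡∣i∣ (+ toℕ b) ⟩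
    toℕ b                              ∎
    where open ≡-Reasoning

  module _ {k x a b} (k<p : k < p) (x∈A : x ∈ A) (a∈A : a ∈ A) (b∈B : b ∈ B)
           (a⊕b≡ : a ⊕ b ≡ x ⊕ fiberStep k) where

    pⁿ∣b : p ^ n ∣ toℕ b
    pⁿ∣b = subst (p ^ n ∣_) (∣diff-0∣ b) (proj₁ (splitting x x∈A) (0 mod M) b σ₀ σb)
      where
      σ₀ : SigmaFiber M B A p x (0 mod M)
      σ₀ = 0∈B , x , x∈A , 0 , ℕ.>-nonZero⁻¹ p , ⊕-comm (0 mod M) x
      σb : SigmaFiber M B A p x b
      σb = b∈B , a , a∈A , k , k<p , trans (⊕-comm b a) a⊕b≡

    tile-≡[mod] : toℕ a ≡ toℕ x + k * (M / p) [mod p ^ n ]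
    tile-≡[mod] = begin
      toℕ a % p ^ n                        ≡⟨ +-∣-≡[mod] (toℕ a) pⁿ∣b ⟨
      (toℕ a + toℕ b) % p ^ n              ≡⟨ ≡[mod]-weaken {d = M} pⁿ∣M a+b≡x+step ⟩
      (toℕ x + toℕ (fiberStep k)) % p ^ n  ≡⟨ ≡[mod]-+ {p ^ n} {toℕ x} refl step≡ ⟩
      (toℕ x + k * (M / p)) % p ^ n        ∎
      where
      open ≡-Reasoning
      a+b≡x+step : toℕ a + toℕ b ≡ toℕ x + toℕ (fiberStep k) [mod M ]
      a+b≡x+step = ⊕-≡⇒≡[mod] {a} {b} {x} {fiberStep k} a⊕b≡
      step≡ : toℕ (fiberStep k) ≡ k * (M / p) [mod p ^ n ]
      step≡ = trans (cong (_% p ^ n) (toℕ-fiberStep k))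
                    (≡[mod]-weaken {d = M} pⁿ∣M (%-≡[mod] (k * (M / p))))

  tile-injective : ∀ {z a b₁ b₂ x₁ x₂} → x₁ ∈ A → x₂ ∈ A → b₁ ∈ B → b₂ ∈ B →
                   a ⊕ b₁ ≡ x₁ ⊕ z → a ⊕ b₂ ≡ x₂ ⊕ z → x₁ ≡ x₂
  tile-injective {z} {a} {b₁} {b₂} {x₁} {x₂} x₁∈A x₂∈A b₁∈B b₂∈B a⊕b₁≡ a⊕b₂≡ =
    proj₁ (proj₂ tiling x₁ x₂ b₂ b₁ x₁∈A x₂∈A b₂∈B b₁∈B
                 (≡[mod]⇒⊕-≡ {x₁} {b₂} {x₂} {b₁} (≡[mod]-cancelˡ-+ (toℕ z) chain)))
    where
    open ≡-Reasoning
    shuffle : ∀ s x b → s + (x + b) ≡ (x + s) + b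
    shuffle = ℕ-Ring.solve-∀
    swap : ∀ a b b′ → (a + b) + b′ ≡ (a + b′) + b
    swap = ℕ-Ring.solve-∀
    a+b₁≡x₁+z : toℕ a + toℕ b₁ ≡ toℕ x₁ + toℕ z [mod M ]
    a+b₁≡x₁+z = ⊕-≡⇒≡[mod] {a} {b₁} {x₁} {z} a⊕b₁≡
    a+b₂≡x₂+z : toℕ a + toℕ b₂ ≡ toℕ x₂ + toℕ z [mod M ]
    a+b₂≡x₂+z = ⊕-≡⇒≡[mod] {a} {b₂} {x₂} {z} a⊕b₂≡
    chain : toℕ z + (toℕ x₁ + toℕ b₂) ≡ toℕ z + (toℕ x₂ + toℕ b₁) [mod M ]
    chain = begin
      (toℕ z + (toℕ x₁ + toℕ b₂)) % M   ≡⟨ cong (_% M) (shuffle (toℕ z) (toℕ x₁) (toℕ b₂)) ⟩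
      ((toℕ x₁ + toℕ z) + toℕ b₂) % M   ≡⟨ ≡[mod]-+ {M} {_} {_} {toℕ b₂} (sym a+b₁≡x₁+z) refl ⟩
      ((toℕ a + toℕ b₁) + toℕ b₂) % M   ≡⟨ cong (_% M) (swap (toℕ a) (toℕ b₁) (toℕ b₂)) ⟩
      ((toℕ a + toℕ b₂) + toℕ b₁) % M   ≡⟨ ≡[mod]-+ {M} {_} {_} {toℕ b₁} a+b₂≡x₂+z refl ⟩
      ((toℕ x₂ + toℕ z) + toℕ b₁) % M   ≡⟨ cong (_% M) (shuffle (toℕ z) (toℕ x₂) (toℕ b₁)) ⟨
      (toℕ z + (toℕ x₂ + toℕ b₁)) % M   ∎

  A-part : Fin M → Fin M
  A-part z = proj₁ (proj₁ tiling z)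

  A-part-∈ : ∀ z → A-part z ∈ A
  A-part-∈ z = proj₁ (proj₂ (proj₂ (proj₁ tiling z)))

  -- extended by the identity off A, so that each translate k is a permutation of Z_M
  translate : ℕ → Fin M → Fin M
  translate k x with x ∈? A
  ... | yes _ = A-part (x ⊕ fiberStep k)
  ... | no  _ = x

  translate-∈ : ∀ k {x} → x ∈ A → translate k x ∈ A
  translate-∈ k {x} x∈A with x ∈? A
  ... | yes _   = A-part-∈ (x ⊕ fiberStep k)
  ... | no  x∉A = contradiction x∈A x∉A

  translate-∉ : ∀ k {x} → x ∉ A → translate k x ≡ x
  translate-∉ k {x} x∉A with x ∈? A
  ... | yes x∈A = contradiction x∈A x∉A
  ... | no  _   = refl

  translate-≡[mod] : ∀ {k x} → k < p → x ∈ A → toℕ (translate k x) ≡ toℕ x + k * (M / p) [mod p ^ n ]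
  translate-≡[mod] {k} {x} k<p x∈A with x ∈? A
  ... | no x∉A = contradiction x∈A x∉A
  ... | yes _ with proj₁ tiling (x ⊕ fiberStep k)
  ...   | a , b , a∈A , b∈B , a⊕b≡ = tile-≡[mod] k<p x∈A a∈A b∈B a⊕b≡

  translate-injective : ∀ k → Injective _≡_ _≡_ (translate k)
  translate-injective k {x} {y} eq with x ∈? A | y ∈? A
  ... | no  _   | no  _   = eq
  ... | yes _   | no  y∉A = contradiction (subst (_∈ A) eq (A-part-∈ (x ⊕ fiberStep k))) y∉A
  ... | no  x∉A | yes _   = contradiction (subst (_∈ A) (sym eq) (A-part-∈ (y ⊕ fiberStep k))) x∉A
  ... | yes x∈A | yes y∈A with proj₁ tiling (x ⊕ fiberStep k) | proj₁ tiling (y ⊕ fiberStep k)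
  ...   | _ , _ , _ , b∈B , a⊕b≡ | _ , b′ , _ , b′∈B , a′⊕b′≡ =
          tile-injective x∈A y∈A b∈B b′∈B a⊕b≡ (subst (λ a → a ⊕ b′ ≡ y ⊕ fiberStep k) (sym eq) a′⊕b′≡)

-- Divisibility of the mask polynomial

module _ (M : ℕ) .{{_ : NonZero M}} (p n c : ℕ) .{{_ : NonZero p}} (p-prime : Prime p) (p∤c : ¬ p ∣ c)
         (M≡cP : M ≡ c * p ^ suc n) (A B : Subset M) (tiling : IsTiling M A B) (0∈B : (0 mod M) ∈ B)
         (splitting : UniformSplittingBA M A B p (suc n)) where

  open Cyclotomic p n
  open Multiples Φ
  open Translation M p (suc n) A B tiling 0∈B splitting (ℕ∣.divides c M≡cP)
  open ≡-Reasoning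

  N : ℕ
  N = M / p

  N≡cq : N ≡ c * q
  N≡cq = trans (cong (_/ p) (trans M≡cP (rearrange c p q))) (m*n/n≡m (c * q) p)
    where
    rearrange : ∀ c p q → c * (p * q) ≡ c * q * p
    rearrange = ℕ-Ring.solve-∀

  χ : Fin M → ℤ
  χ x = maskCoeff M A (toℕ x)

  translated shifted : Fin p → Fin M → Poly
  translated k x = X^ (toℕ (translate (toℕ k) x))
  shifted    k x = X^ (toℕ x + toℕ k * N)

  χ-translate : ∀ k x → χ (translate k x) ≡ χ x
  χ-translate k x = by-membership (x ∈? A)
    where
    by-membership : Dec (x ∈ A) → χ (translate k x) ≡ χ x
    by-membership (yes x∈A) = trans (maskCoeff-∈ M A (translate-∈ k x∈A)) (sym (maskCoeff-∈ M A x∈A))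
    by-membership (no  x∉A) = cong χ (translate-∉ k x∉A)

  ∑-translated : ∀ k i → ∑[ x < M ] (χ x ℤ.* translated k x i) ≡ maskCoeff M A i
  ∑-translated k i = begin
    ∑[ x < M ] (χ x ℤ.* X^ (toℕ (σ x)) i)
      ≡⟨ sum-cong-≗ {M} (λ x → cong (ℤ._* X^ (toℕ (σ x)) i) (χ-translate (toℕ k) x)) ⟨
    ∑[ x < M ] (χ (σ x) ℤ.* X^ (toℕ (σ x)) i)
      ≡⟨ ∑-injective (λ y → χ y ℤ.* X^ (toℕ y) i) (translate-injective (toℕ k)) ⟩
    ∑[ x < M ] (χ x ℤ.* X^ (toℕ x) i)
      ≡⟨ ∑-monomials M (maskCoeff M A) (maskCoeff-≥ M A) i ⟨
    maskCoeff M A i  ∎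
    where
    σ = translate (toℕ k)

  Φ∣translated-shifted :
    PolyDvd Φ (λ i → ∑[ k < p ] ∑[ x < M ] (χ x ℤ.* (translated k x i ℤ.- shifted k x i)))
  Φ∣translated-shifted = PolyDvd-∑ λ k → PolyDvd-∑ λ x → by-membership k x (x ∈? A)
    where
    by-membership : ∀ k x → Dec (x ∈ A) → PolyDvd Φ (λ i → χ x ℤ.* (translated k x i ℤ.- shifted k x i))
    by-membership k x (yes x∈A) = PolyDvd-* (χ x) (Φ∣X^u-X^v (translate-≡[mod] (FinP.toℕ<n k) x∈A))
    by-membership k x (no  x∉A) = PolyDvd-resp (λ i → sym (χ≡0⇒χ*≡0 _)) PolyDvd-0
      where
      χ≡0⇒χ*≡0 : ∀ t → χ x ℤ.* t ≡ 0ℤ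
      χ≡0⇒χ*≡0 t = trans (cong (ℤ._* t) (maskCoeff-∉ M A x∉A)) (ℤP.*-zeroˡ t)

  Φ∣shifted : PolyDvd Φ (λ i → ∑[ k < p ] ∑[ x < M ] (χ x ℤ.* shifted k x i))
  Φ∣shifted = PolyDvd-resp exchange (PolyDvd-∑ λ x → PolyDvd-* (χ x) (PolyDvd-resp (cq≡N x)
                                     (Φ∣∑X^[a+jcq] p-prime p∤c (toℕ x))))
    where
    cq≡N : ∀ x i → ∑[ k < p ] X^ (toℕ x + toℕ k * (c * q)) i ≡ ∑[ k < p ] shifted k x i
    cq≡N x i = sum-cong-≗ {p} (λ k → cong (λ m → X^ (toℕ x + toℕ k * m) i) (sym N≡cq))
    exchange : ∀ i → ∑[ x < M ] (χ x ℤ.* ∑[ k < p ] shifted k x i)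
                     ≡ ∑[ k < p ] ∑[ x < M ] (χ x ℤ.* shifted k x i)
    exchange i = trans (sum-cong-≗ {M} (λ x → *-distribˡ-sum {p} (χ x) _))
                       (∑-comm {M} {p} (λ x k → χ x ℤ.* shifted k x i))

  Φ∣p·mask : PolyDvd Φ (λ i → + p ℤ.* maskCoeff M A i)
  Φ∣p·mask = PolyDvd-resp recombine (PolyDvd-+ Φ∣translated-shifted Φ∣shifted)
    where
    T S : Fin p → Fin M → ℕ → ℤ
    T k x i = χ x ℤ.* translated k x i
    S k x i = χ x ℤ.* shifted k x i
    minus-plus : ∀ w t s → w ℤ.* (t ℤ.- s) ℤ.+ w ℤ.* s ≡ w ℤ.* t
    minus-plus = solve-∀
    recombine : ∀ i → ∑[ k < p ] ∑[ x < M ] (χ x ℤ.* (translated k x i ℤ.- shifted k x i))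
                        ℤ.+ ∑[ k < p ] ∑[ x < M ] S k x i
                      ≡ + p ℤ.* maskCoeff M A i
    recombine i = begin
      ∑[ k < p ] ∑[ x < M ] (χ x ℤ.* (translated k x i ℤ.- shifted k x i)) ℤ.+ ∑[ k < p ] ∑[ x < M ] S k x i
        ≡⟨ ∑-distrib-+ {p} _ _ ⟨
      ∑[ k < p ] (∑[ x < M ] (χ x ℤ.* (translated k x i ℤ.- shifted k x i)) ℤ.+ ∑[ x < M ] S k x i)
        ≡⟨ sum-cong-≗ {p} (λ k → trans (sym (∑-distrib-+ {M} _ _))
             (sum-cong-≗ {M} (λ x → minus-plus (χ x) (translated k x i) (shifted k x i)))) ⟩
      ∑[ k < p ] ∑[ x < M ] T k x i
        ≡⟨ sum-cong-≗ {p} (λ k → ∑-translated k i) ⟩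
      ∑[ k < p ] maskCoeff M A i
        ≡⟨ ∑-const p (maskCoeff M A i) ⟩
      + p ℤ.* maskCoeff M A i  ∎

  Φ∣mask : PolyDvd Φ (maskCoeff M A)
  Φ∣mask = PolyDvd-cancelˡ (+ p) Φ-0 Φ∣p·mask

corollary4p9 : (M : ℕ) .{{_ : NonZero M}} (p n : ℕ) → (pp : Prime p) → 1 ≤ n →
    (p ^ n) ∣ M → ¬ ((p ^ (suc n)) ∣ M) →
    (A B : Subset M) → IsTiling M A B →
    (0 mod M) ∈ B →
    UniformSplittingBA M A B p {{prime⇒nonZero pp}} n →
    PolyDvd (cyclotomicPrimePower p n) (maskCoeff M A)
corollary4p9 M p (suc n) p-prime (s≤s z≤n) (ℕ∣.divides c M≡cP) pⁿ⁺¹∤M A B tiling 0∈B splitting =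
  Φ∣mask M p n c {{prime⇒nonZero p-prime}} p-prime p∤c M≡cP A B tiling 0∈B splitting
  where
  p∤c : ¬ p ∣ c
  p∤c p∣c = pⁿ⁺¹∤M (subst (p ^ suc (suc n) ∣_) (sym M≡cP) (ℕ∣.*-monoˡ-∣ (p ^ suc n) p∣c))
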